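{- Let $\mathbf{a}=(a_n)_{n\ge0}$ be a sequence in $\mathbb{F}_q$ which is not ultimately periodic, and put $\xi:=\sum_{n=0}^\infty a_nT^{ -n}$. Assume there are integers $n_0\ge1$ and $\kappa\ge2$ such that $p(\mathbf{a},n)\le\kappa n$ for all $n\ge n_0$. If $\mathrm{Dio}(\mathbf{a})$ is finite, then $w_1(\xi)\le8(\kappa+1)^2(2\kappa+1)\mathrm{Dio}(\mathbf{a})-1$.
   Context: $p$ prime, $q$ a power of $p$; $\mathbb{F}_q((T^{ -1}))$ with $|\sum_{n\ge N}a_nT^{ -n}|=q^{ -N}$ ($a_N\ne0$). $H(P)$ is the maximum absolute value of the coefficients of $P\in(\mathbb{F}_q[T])[X]$; $w_1(\xi)$ is the supremum of $w$ such that $0<|P(\xi)|\le H(P)^{ -w}$ for infinitely many $P\in(\mathbb{F}_q[T])[X]$ of degree at most $1$. $p(\mathbf{a},n)$ is the number of distinct words $a_ia_{i+1}\cdots a_{i+n-1}$, $i\ge0$. Words: $W^w=W^{\lfloor w\rfloor}W'$ with $W'$ the prefix of $W$ of length $\lceil(w-\lfloor w\rfloor)|W|\rceil$. $\mathbf{a}$ satisfies $(*)_\rho$ if there are finite words $U_n,V_n$ and reals $w_n\ge0$ with $U_nV_n^{w_n}$ a prefix of $\mathbf{a}$, $|U_nV_n^{w_n}|/|U_nV_n|\ge\rho$, and $(|V_n^{w_n}|)_n$ strictly increasing; $\mathrm{Dio}(\mathbf{a})$ is the supremum of such $\rho$. -}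

module Defs where

open import Level using (Level; _⊔_)
open import Algebra.Bundles using (CommutativeRing)
open import Data.Nat as ℕ using (ℕ; zero; suc; _<_; _≤_)
open import Data.Nat.DivMod using (_/_; _%_)
open import Data.Integer as ℤ using (ℤ; +_; -[1+_])
open import Data.Rational as ℚ using (ℚ)
open import Data.Fin using (Fin; toℕ; fromℕ<)
open import Data.List as List using (List; []; _∷_; _++_; length; replicate; concat; take; drop)
open import Data.List.Relation.Unary.Any using (Any)
open import Data.Vec as Vec using (Vec)
open import Data.Product using (Σ; ∃; ∃-syntax; _×_; _,_)
open import Data.Sum using (_⊎_)
open import Relation.Nullary using (¬_)
open import Relation.Binary.PropositionalEquality using (_≡_)

-- Standing data: F is a commutative ring (the field F_q, see IsField/HasCard).
module _ {c ℓ : Level} (F : CommutativeRing c ℓ) where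
  open CommutativeRing F renaming (Carrier to C)

  IsField : Set (c ⊔ ℓ)
  IsField = (¬ (0# ≈ 1#)) × (∀ x → ¬ (x ≈ 0#) → ∃[ y ] (x * y ≈ 1#))

  HasCard : ℕ → Set (c ⊔ ℓ)
  HasCard q = Σ (Fin q → C) λ e →
    (∀ x → ∃[ i ] (e i ≈ x)) × (∀ i j → e i ≈ e j → i ≡ j)

  UltPeriodic : (ℕ → C) → Set ℓ
  UltPeriodic a = ∃[ N ] ∃[ t ] (1 ℕ.≤ t × (∀ n → N ℕ.≤ n → a (t ℕ.+ n) ≈ a n))

  -- p(a,n) ≤ m : the factors a_i … a_{i+n-1} (i ≥ 0) take at most m distinct values,
  -- i.e. they are all among a list of at most m words of length n.
  ComplexityLe : (ℕ → C) → ℕ → ℕ → Set (c ⊔ ℓ)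
  ComplexityLe a n m = Σ (List (Vec C n)) λ L → length L ℕ.≤ m ×
    (∀ i → Any (λ W → ∀ (j : Fin n) → Vec.lookup W j ≈ a (i ℕ.+ toℕ j)) L)

  IsPrefix : List C → (ℕ → C) → Set ℓ
  IsPrefix W a = ∀ i → (lt : i ℕ.< length W) → List.lookup W (fromℕ< lt) ≈ a i

  -- ⌈ x / (d+1) ⌉
  ceilDivSuc : ℕ → ℕ → ℕ
  ceilDivSuc x d = (x ℕ.+ d) / suc d

  -- W^w for the nonnegative rational exponent w = k/(d+1):
  -- W^{⌊w⌋} W' with W' the prefix of W of length ⌈(w - ⌊w⌋)|W|⌉.
  pow : List C → ℕ → ℕ → List C
  pow W k d = concat (replicate (k / suc d) W)
              ++ take (ceilDivSuc ((k % suc d) ℕ.* length W) d) W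

  Star : (ℕ → C) → ℚ → Set (c ⊔ ℓ)
  Star a ρ = Σ (ℕ → List C) λ U → Σ (ℕ → List C) λ V →
             Σ (ℕ → ℕ) λ k → Σ (ℕ → ℕ) λ d →
      (∀ n → IsPrefix (U n ++ pow (V n) (k n) (d n)) a)
    × (∀ n → ρ ℚ.* (+ length (U n ++ V n) ℚ./ 1)
               ℚ.≤ (+ length (U n ++ pow (V n) (k n) (d n)) ℚ./ 1))
    × (∀ n → length (pow (V n) (k n) (d n)) ℕ.< length (pow (V (suc n)) (k (suc n)) (d (suc n))))

  -- Polynomials in F[T] as coefficient lists (constant term first)

  coeff : List C → ℕ → C
  coeff []       _       = 0#
  coeff (x ∷ _)  zero    = x
  coeff (_ ∷ xs) (suc i) = coeff xs i

  PolyEq : List C → List C → Set ℓ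
  PolyEq A A' = ∀ i → coeff A i ≈ coeff A' i

  mulAt : List C → (ℕ → C) → C
  mulAt []      s = 0#
  mulAt (x ∷ A) s = x * s 0 + mulAt A (λ j → s (suc j))

  -- coefficient of T^m in A·ξ + B, where ξ = Σ_{n≥0} a_n T^{-n}
  coeffT : (ℕ → C) → List C → List C → ℤ → C
  coeffT a A B (+ m)     = mulAt (drop m A) a + coeff B m
  coeffT a A B -[1+ n ]  = mulAt A (λ j → a (j ℕ.+ suc n))

  -- |A ξ + B| = q^{-N}  (in particular A ξ + B ≠ 0)
  AbsExp : (ℕ → C) → List C → List C → ℤ → Set ℓ
  AbsExp a A B N = (¬ (coeffT a A B (ℤ.- N) ≈ 0#))
                 × (∀ M → M ℤ.< N → coeffT a A B (ℤ.- M) ≈ 0#)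

  -- H(A X + B) = q^h
  HeightExp : List C → List C → ℕ → Set ℓ
  HeightExp A B h = ((¬ (coeff A h ≈ 0#)) ⊎ (¬ (coeff B h ≈ 0#)))
                  × (∀ i → h ℕ.< i → (coeff A i ≈ 0#) × (coeff B i ≈ 0#))

  -- 0 < |P(ξ)| ≤ H(P)^{-w}  for P = A X + B, i.e. q^{-N} ≤ q^{-h w}, i.e. h·w ≤ N
  Good : (ℕ → C) → ℚ → List C × List C → Set ℓ
  Good a w (A , B) = ∃[ h ] ∃[ N ] (HeightExp A B h × AbsExp a A B N
                       × ((+ h ℚ./ 1) ℚ.* w ℚ.≤ (N ℚ./ 1)))

  PEq : List C × List C → List C × List C → Set ℓ
  PEq (A , B) (A' , B') = PolyEq A A' × PolyEq B B'

  -- infinitely many P of degree ≤ 1 with 0 < |P(ξ)| ≤ H(P)^{-w}: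
  -- no finite list of polynomials contains all of them
  InfinitelyMany : (ℕ → C) → ℚ → Set (c ⊔ ℓ)
  InfinitelyMany a w = ∀ (L : List (List C × List C)) →
    ∃[ P ] (Good a w P × ¬ Any (PEq P) L)

constA2 : ℕ → ℕ
constA2 κ = 8 ℕ.* ((κ ℕ.+ 1) ℕ.* (κ ℕ.+ 1)) ℕ.* (2 ℕ.* κ ℕ.+ 1)

module Submission where

-- Suppose infinitely many P = A X + B satisfy
-- 0 < |P(ξ)| ≤ H(P)^{-w}, where (K + 1)ρ - 1 < w for some K > κ. For every P₀ we produce a prefix
-- U V^w of a with |U V^w| ≥ ρ|UV| and |V^w| > P₀ (a "witness"); chaining witnesses of increasing
-- length yields (*)_ρ.
--   * If ρ ≤ 1 a witness is trivial (U empty, V a long prefix).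
--   * If ρ > 1, take an approximation A X + B of height q^h with h large (only finitely many
--     polynomials have small height). Writing |Aξ + B| = q^{-N}, we get hw ≤ N and hence N > hK.
--     The vanishing coefficients of T^{-1}, …, T^{1-N} in Aξ + B say that a satisfies the linear
--     recurrence Σ_t A_t a_{t+x} = 0 for 1 ≤ x < N. Since p(a, m) ≤ κm, two windows of length
--     m = h + n₀ ≥ deg A coincide at positions i < j ≤ κm + 1 (pigeonhole); the recurrence then
--     propagates the equality a_{i+t} = a_{j+t} up to position N, so a_0 … a_{N-1} = U V^w with
--     |UV| = j ≤ hK < ρ^{-1}N and |V^w| = N - i, which is large.

open import Level using (Level)
open import Algebra.Bundles using (CommutativeRing)
open import Data.Nat as ℕ using (ℕ)
open import Data.Rational as ℚ using (ℚ)
open import Defs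

module RationalBounds where
  open import Data.Nat as ℕ using (ℕ; suc; _≤_; _<_)
  open import Data.Integer as ℤ using (ℤ; +_; +<+)
  import Data.Integer.Properties as ℤP
  open import Data.Rational as ℚ using (ℚ; _/_; 0ℚ; 1ℚ; *≤*; *<*)
  open import Data.Rational.Literals using (fromℤ)
  import Data.Rational.Properties as ℚP
  open import Data.Rational.Solver using (module +-*-Solver)
  open import Data.Product using (∃-syntax; _×_; _,_)
  open import Relation.Binary.PropositionalEquality

  fromℕ : ℕ → ℚ
  fromℕ n = fromℤ (+ n)

  /1≡fromℤ : ∀ z → z / 1 ≡ fromℤ z
  /1≡fromℤ z = ℚP.↥p/↧p≡p (fromℤ z)

  fromℤ-mono-≤ : ∀ {a b} → a ℤ.≤ b → fromℤ a ℚ.≤ fromℤ b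
  fromℤ-mono-≤ {a} {b} a≤b = *≤* (subst₂ ℤ._≤_ (sym (ℤP.*-identityʳ a)) (sym (ℤP.*-identityʳ b)) a≤b)

  fromℤ-cancel-< : ∀ {a b} → fromℤ a ℚ.< fromℤ b → a ℤ.< b
  fromℤ-cancel-< {a} {b} (*<* a<b) = subst₂ ℤ._<_ (ℤP.*-identityʳ a) (ℤP.*-identityʳ b) a<b

  fromℕ-+ : ∀ m n → fromℕ (m ℕ.+ n) ≡ fromℕ m ℚ.+ fromℕ n
  fromℕ-+ m n = sym (trans (cong (_/ 1) (cong₂ ℤ._+_ (ℤP.*-identityʳ (+ m)) (ℤP.*-identityʳ (+ n))))
                           (/1≡fromℤ (+ (m ℕ.+ n))))

  fromℕ-* : ∀ m n → fromℕ (m ℕ.* n) ≡ fromℕ m ℚ.* fromℕ n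
  fromℕ-* m n = sym (trans (cong (_/ 1) (sym (ℤP.pos-* m n))) (/1≡fromℤ (+ (m ℕ.* n))))

  scale-≤ : ∀ ρ x → ρ ℚ.≤ 1ℚ → ρ ℚ.* fromℕ x ℚ.≤ fromℕ x
  scale-≤ ρ x ρ≤1 = subst (ρ ℚ.* fromℕ x ℚ.≤_) (ℚP.*-identityˡ (fromℕ x)) (ℚP.*-monoʳ-≤-nonNeg (fromℕ x) ρ≤1)

  height-identity : ∀ h K ρ → h ℚ.* ((1ℚ ℚ.+ K) ℚ.* ρ ℚ.- 1ℚ) ≡ ρ ℚ.* (h ℚ.* K) ℚ.+ h ℚ.* (ρ ℚ.- 1ℚ)
  height-identity = solve 3 (λ h K ρ → h :* ((con 1ℚ :+ K) :* ρ :- con 1ℚ) := ρ :* (h :* K) :+ h :* (ρ :- con 1ℚ)) refl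
    where open +-*-Solver

  scaled-height< : ∀ (ρ w : ℚ) (K h : ℕ) (N : ℤ) → fromℕ (suc K) ℚ.* ρ ℚ.- 1ℚ ℚ.< w → 1ℚ ℚ.< ρ →
    1 ≤ h → fromℕ h ℚ.* w ℚ.≤ fromℤ N → ρ ℚ.* fromℕ (h ℕ.* K) ℚ.< fromℤ N
  scaled-height< ρ w K h@(suc _) N hyp 1<ρ _ hw≤N = begin-strict
    ρ ℚ.* fromℕ (h ℕ.* K)                                   ≡⟨ cong (ρ ℚ.*_) (fromℕ-* h K) ⟩
    ρ ℚ.* (fromℕ h ℚ.* fromℕ K)                             ≡⟨ sym (ℚP.+-identityʳ _) ⟩
    ρ ℚ.* (fromℕ h ℚ.* fromℕ K) ℚ.+ 0ℚ                      ≤⟨ ℚP.+-monoʳ-≤ (ρ ℚ.* (fromℕ h ℚ.* fromℕ K)) 0≤h[ρ-1] ⟩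
    ρ ℚ.* (fromℕ h ℚ.* fromℕ K) ℚ.+ fromℕ h ℚ.* (ρ ℚ.- 1ℚ) ≡⟨ sym (height-identity (fromℕ h) (fromℕ K) ρ) ⟩
    fromℕ h ℚ.* ((1ℚ ℚ.+ fromℕ K) ℚ.* ρ ℚ.- 1ℚ)            ≡⟨ cong (λ z → fromℕ h ℚ.* (z ℚ.* ρ ℚ.- 1ℚ)) (sym (fromℕ-+ 1 K)) ⟩
    fromℕ h ℚ.* (fromℕ (suc K) ℚ.* ρ ℚ.- 1ℚ)               <⟨ ℚP.*-monoʳ-<-pos (fromℕ h) hyp ⟩
    fromℕ h ℚ.* w                                           ≤⟨ hw≤N ⟩
    fromℤ N                                                 ∎
    where
    open ℚP.≤-Reasoning
    0≤ρ-1 : 0ℚ ℚ.≤ ρ ℚ.- 1ℚ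
    0≤ρ-1 = subst (ℚ._≤ ρ ℚ.- 1ℚ) (ℚP.+-inverseʳ 1ℚ) (ℚP.+-monoˡ-≤ (ℚ.- 1ℚ) (ℚP.<⇒≤ 1<ρ))
    0≤h[ρ-1] : 0ℚ ℚ.≤ fromℕ h ℚ.* (ρ ℚ.- 1ℚ)
    0≤h[ρ-1] = subst (ℚ._≤ fromℕ h ℚ.* (ρ ℚ.- 1ℚ)) (ℚP.*-zeroʳ (fromℕ h)) (ℚP.*-monoˡ-≤-nonNeg (fromℕ h) 0≤ρ-1)

  scaled-height-bound : ∀ (ρ w : ℚ) (K h : ℕ) (N : ℤ) → fromℕ (suc K) ℚ.* ρ ℚ.- 1ℚ ℚ.< w → 1ℚ ℚ.< ρ →
    1 ≤ h → fromℕ h ℚ.* w ℚ.≤ fromℤ N →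
    ∃[ n ] (N ≡ + n × h ℕ.* K < n × (∀ x → x ≤ h ℕ.* K → ρ ℚ.* fromℕ x ℚ.≤ fromℕ n))
  scaled-height-bound ρ w K h N hyp 1<ρ 1≤h hw≤N = natural N (fromℤ-cancel-< (ℚP.≤-<-trans hK≤ρhK ρhK<N)) ρhK<N
    where
    instance
      ρ-nonNeg : ℚ.NonNegative ρ
      ρ-nonNeg = ℚ.nonNegative (ℚP.<⇒≤ (ℚP.<-trans (*<* (+<+ (ℕ.s≤s ℕ.z≤n))) 1<ρ))
    ρhK<N : ρ ℚ.* fromℕ (h ℕ.* K) ℚ.< fromℤ N
    ρhK<N = scaled-height< ρ w K h N hyp 1<ρ 1≤h hw≤N
    hK≤ρhK : fromℕ (h ℕ.* K) ℚ.≤ ρ ℚ.* fromℕ (h ℕ.* K)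
    hK≤ρhK = subst (ℚ._≤ ρ ℚ.* fromℕ (h ℕ.* K)) (ℚP.*-identityˡ _) (ℚP.*-monoʳ-≤-nonNeg (fromℕ (h ℕ.* K)) (ℚP.<⇒≤ 1<ρ))
    natural : ∀ M → + (h ℕ.* K) ℤ.< M → ρ ℚ.* fromℕ (h ℕ.* K) ℚ.< fromℤ M →
      ∃[ n ] (M ≡ + n × h ℕ.* K < n × (∀ x → x ≤ h ℕ.* K → ρ ℚ.* fromℕ x ℚ.≤ fromℕ n))
    natural (+ n) (+<+ hK<n) ρhK<n = n , refl , hK<n , λ x x≤hK →
      ℚP.<⇒≤ (ℚP.≤-<-trans (ℚP.*-monoˡ-≤-nonNeg ρ (fromℤ-mono-≤ (ℤ.+≤+ x≤hK))) ρhK<n)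

module LinearRecurrence {c ℓ : Level} (F : CommutativeRing c ℓ) where
  open CommutativeRing F renaming (Carrier to C)
  open import Algebra.Properties.Group +-group using (inverseʳ-unique)
  open import Relation.Binary.Reasoning.Setoid setoid
  open import Data.Nat as ℕ using (ℕ; zero; suc; z≤n; s≤s; _≤_; _<_; _∸_)
  import Data.Nat.Properties as ℕP
  open import Data.Nat.Induction using (<-rec)
  open import Algebra.Properties.CommutativeSemigroup ℕP.+-commutativeSemigroup using (x∙yz≈y∙xz)
  open import Data.List using (List; []; _∷_; length; take)
  open import Data.List.Properties using (length-take)
  open import Data.Product using (∃-syntax; _×_; _,_; proj₂)
  open import Relation.Nullary using (¬_; yes; no)
  open import Relation.Binary.PropositionalEquality as ≡ using (_≡_)

  IsDegree : List C → ℕ → Set ℓ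
  IsDegree A d = ¬ (coeff F A d ≈ 0#) × (∀ i → d < i → coeff F A i ≈ 0#)

  Satisfies : List C → (ℕ → C) → ℕ → Set ℓ
  Satisfies A s L = ∀ u → u < L → mulAt F A (λ t → s (t ℕ.+ u)) ≈ 0#

  mulAt-cong : ∀ A {s s'} → (∀ t → t < length A → s t ≈ s' t) → mulAt F A s ≈ mulAt F A s'
  mulAt-cong []      s≈s' = refl
  mulAt-cong (x ∷ A) s≈s' = +-cong (*-congˡ (s≈s' 0 (s≤s z≤n))) (mulAt-cong A (λ t t< → s≈s' (suc t) (s≤s t<)))

  mulAt-zero : ∀ A s → (∀ i → coeff F A i ≈ 0#) → mulAt F A s ≈ 0#
  mulAt-zero []      s A≈0 = refl
  mulAt-zero (x ∷ A) s A≈0 = begin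
    x * s 0 + mulAt F A (λ t → s (suc t)) ≈⟨ +-cong (*-congʳ (A≈0 0)) (mulAt-zero A _ (λ i → A≈0 (suc i))) ⟩
    0# * s 0 + 0#                         ≈⟨ +-identityʳ _ ⟩
    0# * s 0                              ≈⟨ zeroˡ _ ⟩
    0#                                    ∎

  empty-top : ∀ x → 0# ≈ 0# + 0# * x
  empty-top x = begin
    0#           ≈⟨ sym (+-identityʳ 0#) ⟩
    0# + 0#      ≈⟨ +-congˡ (sym (zeroˡ x)) ⟩
    0# + 0# * x  ∎

  mulAt-top : ∀ A d s → (∀ i → d < i → coeff F A i ≈ 0#) →
    mulAt F A s ≈ mulAt F (take d A) s + coeff F A d * s d
  mulAt-top []      zero    s _ = empty-top (s 0)
  mulAt-top []      (suc d) s _ = empty-top (s (suc d))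
  mulAt-top (x ∷ A) zero    s high = begin
    x * s 0 + mulAt F A (λ t → s (suc t)) ≈⟨ +-congˡ (mulAt-zero A _ (λ i → high (suc i) (s≤s z≤n))) ⟩
    x * s 0 + 0#                          ≈⟨ +-comm _ _ ⟩
    0# + x * s 0                          ∎
  mulAt-top (x ∷ A) (suc d) s high = begin
    x * s 0 + mulAt F A (λ t → s (suc t))
      ≈⟨ +-congˡ (mulAt-top A d _ (λ i d<i → high (suc i) (s≤s d<i))) ⟩
    x * s 0 + (mulAt F (take d A) (λ t → s (suc t)) + coeff F A d * s (suc d))
      ≈⟨ sym (+-assoc _ _ _) ⟩
    x * s 0 + mulAt F (take d A) (λ t → s (suc t)) + coeff F A d * s (suc d) ∎

  invertible-cancelˡ : ∀ {x y u v} → x * y ≈ 1# → x * u ≈ x * v → u ≈ v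
  invertible-cancelˡ {x} {y} {u} {v} xy≈1 xu≈xv = begin
    u             ≈⟨ sym (*-identityˡ u) ⟩
    1# * u        ≈⟨ *-congʳ (trans (sym xy≈1) (*-comm x y)) ⟩
    (y * x) * u   ≈⟨ *-assoc y x u ⟩
    y * (x * u)   ≈⟨ *-congˡ xu≈xv ⟩
    y * (x * v)   ≈⟨ sym (*-assoc y x v) ⟩
    (y * x) * v   ≈⟨ *-congʳ (trans (*-comm y x) xy≈1) ⟩
    1# * v        ≈⟨ *-identityˡ v ⟩
    v             ∎

  -- Over a field, one relation Σ_t A_t s_t = 0 determines s_d from s_0, …, s_{d-1}
  -- when d is the degree of A: it reads A_d s_d = -Σ_{t<d} A_t s_t.
  next-term-unique : IsField F → ∀ {A d} → IsDegree A d → ∀ {s s'} →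
    mulAt F A s ≈ 0# → mulAt F A s' ≈ 0# → (∀ t → t < d → s t ≈ s' t) → s d ≈ s' d
  next-term-unique fld {A} {d} (lead≉0 , high) {s} {s'} rel rel' agree =
    invertible-cancelˡ (proj₂ inverse) (begin
      lead * s d        ≈⟨ inverseʳ-unique (lower s) _ (trans (sym (mulAt-top A d s high)) rel) ⟩
      - lower s         ≈⟨ -‿cong (mulAt-cong (take d A) below) ⟩
      - lower s'        ≈⟨ sym (inverseʳ-unique (lower s') _ (trans (sym (mulAt-top A d s' high)) rel')) ⟩
      lead * s' d       ∎)
    where
    lead : C
    lead = coeff F A d
    inverse : ∃[ y ] (lead * y ≈ 1#)
    inverse = proj₂ fld lead lead≉0
    lower : (ℕ → C) → C
    lower f = mulAt F (take d A) f
    below : ∀ t → t < length (take d A) → s t ≈ s' t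
    below t t< = agree t (ℕP.<-≤-trans t< (≡.subst (_≤ d) (≡.sym (length-take d A)) (ℕP.m⊓n≤m d (length A))))

  recurrence-unique : IsField F → ∀ {A d L s s'} → IsDegree A d → Satisfies A s L → Satisfies A s' L →
    (∀ t → t < d → s t ≈ s' t) → ∀ t → t < L ℕ.+ d → s t ≈ s' t
  recurrence-unique fld {A} {d} {L} {s} {s'} deg sat sat' initial = <-rec _ step
    where
    step : ∀ t → (∀ {t'} → t' < t → t' < L ℕ.+ d → s t' ≈ s' t') → t < L ℕ.+ d → s t ≈ s' t
    step t ih t<L+d with t ℕ.<? d
    ... | yes t<d = initial t t<d
    ... | no  t≮d = ≡.subst (λ z → s z ≈ s' z) d+u≡t
          (next-term-unique fld {A} deg (sat u u<L) (sat' u u<L) shifted-agree)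
      where
      u : ℕ
      u = t ∸ d
      d+u≡t : d ℕ.+ u ≡ t
      d+u≡t = ℕP.m+[n∸m]≡n (ℕP.≮⇒≥ t≮d)
      u<L : u < L
      u<L = ℕP.+-cancelʳ-< d u L (≡.subst (_< L ℕ.+ d) (≡.sym (≡.trans (ℕP.+-comm u d) d+u≡t)) t<L+d)
      shifted-agree : ∀ t' → t' < d → s (t' ℕ.+ u) ≈ s' (t' ℕ.+ u)
      shifted-agree t' t'<d = ih t'+u<t (ℕP.<-trans t'+u<t t<L+d)
        where
        t'+u<t : t' ℕ.+ u < t
        t'+u<t = ≡.subst (t' ℕ.+ u <_) d+u≡t (ℕP.+-monoˡ-< u t'<d)

  window-propagates : IsField F → ∀ (a : ℕ → C) {A d} N i j → IsDegree A d →
    (∀ x → 1 ≤ x → x < N → mulAt F A (λ t → a (t ℕ.+ x)) ≈ 0#) → 1 ≤ i → i < j →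
    (∀ s → s < d → a (i ℕ.+ s) ≈ a (j ℕ.+ s)) → ∀ t → j ℕ.+ t < N → a (i ℕ.+ t) ≈ a (j ℕ.+ t)
  window-propagates fld a {A} {d} N i j deg rec 1≤i i<j window t j+t<N =
    recurrence-unique fld {A} deg (read-from i 1≤i (ℕP.<⇒≤ i<j)) (read-from j 1≤j ℕP.≤-refl) window t t<L+d
    where
    1≤j : 1 ≤ j
    1≤j = ℕP.≤-trans 1≤i (ℕP.<⇒≤ i<j)
    j≤N : j ≤ N
    j≤N = ℕP.≤-trans (ℕP.m≤m+n j t) (ℕP.<⇒≤ j+t<N)
    L : ℕ
    L = N ∸ j
    read-from : ∀ p → 1 ≤ p → p ≤ j → Satisfies A (λ t → a (p ℕ.+ t)) L
    read-from p 1≤p p≤j u u<L =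
      trans (mulAt-cong A (λ t _ → reflexive (≡.cong a (x∙yz≈y∙xz p t u))))
            (rec (p ℕ.+ u) (ℕP.≤-trans 1≤p (ℕP.m≤m+n p u)) p+u<N)
      where
      p+u<N : p ℕ.+ u < N
      p+u<N = ℕP.≤-<-trans (ℕP.+-monoˡ-≤ u p≤j)
                (≡.subst (j ℕ.+ u <_) (ℕP.m+[n∸m]≡n j≤N) (ℕP.+-monoʳ-< j u<L))
    t<L+d : t < L ℕ.+ d
    t<L+d = ℕP.<-≤-trans (ℕP.+-cancelˡ-< j t L (≡.subst (j ℕ.+ t <_) (≡.sym (ℕP.m+[n∸m]≡n j≤N)) j+t<N))
                         (ℕP.m≤m+n L d)

module FiniteRing {c ℓ : Level} (F : CommutativeRing c ℓ) {q : ℕ} (card : HasCard F q) where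
  open CommutativeRing F renaming (Carrier to C)
  open LinearRecurrence F using (IsDegree)
  open import Data.Nat as ℕ using (zero; suc; z≤n; s≤s; _<_)
  import Data.Nat.Properties as ℕP
  open import Data.Fin using (Fin)
  import Data.Fin.Properties as FinP
  open import Data.List as List using (List; []; _∷_; drop; cartesianProduct; allFin)
  open import Data.List.Membership.Propositional using (_∈_; lose)
  open import Data.List.Membership.Propositional.Properties using (∈-cartesianProduct⁺; ∈-map⁺; ∈-allFin)
  open import Data.List.Relation.Unary.Any using (Any; here)
  open import Data.Product using (∃-syntax; _×_; _,_; proj₁; proj₂)
  open import Data.Sum using (_⊎_; inj₁; inj₂)
  open import Relation.Nullary using (Dec; yes; no)
  open import Relation.Binary.PropositionalEquality as ≡ using (_≡_)

  enum : Fin q → C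
  enum = proj₁ card

  -- Equality in F is decidable: compare the indices of the two elements in the enumeration.
  _≟_ : ∀ x y → Dec (x ≈ y)
  x ≟ y with proj₁ (proj₂ card) x | proj₁ (proj₂ card) y
  ... | i , eᵢ≈x | j , eⱼ≈y with i FinP.≟ j
  ... | yes ≡.refl = yes (trans (sym eᵢ≈x) eⱼ≈y)
  ... | no  i≢j    = no (λ x≈y → i≢j (proj₂ (proj₂ card) i j (trans eᵢ≈x (trans x≈y (sym eⱼ≈y)))))

  degree-or-zero : ∀ A n → (∀ i → n < i → coeff F A i ≈ 0#) →
    (∃[ d ] (d ℕ.≤ n × IsDegree A d)) ⊎ (∀ i → coeff F A i ≈ 0#)
  degree-or-zero A n high with coeff F A n ≟ 0#
  ... | no  Aₙ≉0 = inj₁ (n , ℕP.≤-refl , Aₙ≉0 , high)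
  degree-or-zero A zero    high | yes A₀≈0 = inj₂ λ { zero → A₀≈0 ; (suc i) → high (suc i) (s≤s z≤n) }
  degree-or-zero A (suc n) high | yes Aₙ≈0 with degree-or-zero A n high'
    where
    high' : ∀ i → n < i → coeff F A i ≈ 0#
    high' i n<i with ℕP.m≤n⇒m<n∨m≡n n<i
    ... | inj₁ 1+n<i  = high i 1+n<i
    ... | inj₂ ≡.refl = Aₙ≈0
  ... | inj₁ (d , d≤n , deg) = inj₁ (d , ℕP.m≤n⇒m≤1+n d≤n , deg)
  ... | inj₂ zero-poly       = inj₂ zero-poly

  coeff-drop1 : ∀ A i → coeff F A (suc i) ≡ coeff F (drop 1 A) i
  coeff-drop1 []      i = ≡.refl
  coeff-drop1 (x ∷ A) i = ≡.refl

  coefficientLists : ℕ → List (List C)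
  coefficientLists zero    = [] ∷ []
  coefficientLists (suc H) = List.map (λ (x , A) → x ∷ A)
    (cartesianProduct (List.map enum (allFin q)) (coefficientLists H))

  coefficientLists-complete : ∀ H A → (∀ i → H ℕ.≤ i → coeff F A i ≈ 0#) →
    ∃[ A' ] (A' ∈ coefficientLists H × PolyEq F A A')
  coefficientLists-complete zero    A high = [] , here ≡.refl , λ i → high i z≤n
  coefficientLists-complete (suc H) A high
    with proj₁ (proj₂ card) (coeff F A 0)
       | coefficientLists-complete H (drop 1 A)
           (λ i H≤i → ≡.subst (_≈ 0#) (coeff-drop1 A i) (high (suc i) (s≤s H≤i)))
  ... | k , eₖ≈A₀ | A' , A'∈ , A≈A' =
    enum k ∷ A' , ∈-map⁺ _ (∈-cartesianProduct⁺ (∈-map⁺ enum (∈-allFin k)) A'∈) , same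
    where
    same : PolyEq F A (enum k ∷ A')
    same zero    = sym eₖ≈A₀
    same (suc i) = ≡.subst (_≈ coeff F A' i) (≡.sym (coeff-drop1 A i)) (A≈A' i)

  boundedPolys : ℕ → List (List C × List C)
  boundedPolys H = cartesianProduct (coefficientLists H) (coefficientLists H)

  boundedPolys-complete : ∀ H A B → (∀ i → H ℕ.≤ i → coeff F A i ≈ 0#) → (∀ i → H ℕ.≤ i → coeff F B i ≈ 0#) →
    Any (PEq F (A , B)) (boundedPolys H)
  boundedPolys-complete H A B highA highB
    with coefficientLists-complete H A highA | coefficientLists-complete H B highB
  ... | A' , A'∈ , A≈A' | B' , B'∈ , B≈B' = lose (∈-cartesianProduct⁺ A'∈ B'∈) (A≈A' , B≈B')

module Words {c ℓ : Level} (F : CommutativeRing c ℓ) where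
  open CommutativeRing F using (_≈_; refl; sym; trans) renaming (Carrier to C)
  open import Data.Nat as ℕ using (zero; suc; z≤n; s≤s; _<_; _+_; _*_; _∸_; _/_; _%_)
  import Data.Nat.Properties as ℕP
  open import Data.Nat.DivMod using (m≡m%n+[m/n]*n; m%n<n; +-distrib-/-∣ˡ; m*n/n≡m; m<n⇒m/n≡0)
  open import Data.Nat.Divisibility using (n∣m*n)
  open import Data.Fin using (fromℕ<)
  open import Data.List using (List; []; _∷_; _++_; length; take; concat; replicate; lookup)
  open import Data.List.Properties using (length-++; length-take)
  open import Relation.Binary.PropositionalEquality as ≡ using (_≡_; cong; cong₂; subst)

  Matches : List C → (ℕ → C) → Set ℓ
  Matches W f = ∀ t → t < length W → coeff F W t ≈ f t

  lookup≡coeff : ∀ W i (i<|W| : i < length W) → lookup W (fromℕ< i<|W|) ≡ coeff F W i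
  lookup≡coeff (x ∷ W) zero    _         = ≡.refl
  lookup≡coeff (x ∷ W) (suc i) (s≤s i<) = lookup≡coeff W i i<

  matches⇒prefix : ∀ W a → Matches W a → IsPrefix F W a
  matches⇒prefix W a match i i< = subst (_≈ a i) (≡.sym (lookup≡coeff W i i<)) (match i i<)

  matches-cong : ∀ W {f g} → (∀ t → f t ≡ g t) → Matches W f → Matches W g
  matches-cong W f≡g match t t< = subst (coeff F W t ≈_) (f≡g t) (match t t<)

  matches-++ : ∀ X Y f → Matches X f → Matches Y (λ t → f (length X + t)) → Matches (X ++ Y) f
  matches-++ []      Y f _   matchY = matchY
  matches-++ (x ∷ X) Y f matchX matchY zero    _        = matchX zero (s≤s z≤n)
  matches-++ (x ∷ X) Y f matchX matchY (suc t) (s≤s t<) =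
    matches-++ X Y (λ t → f (suc t)) (λ t t< → matchX (suc t) (s≤s t<)) matchY t t<

  matches-take : ∀ r V f → (∀ t → t < r → t < length V → coeff F V t ≈ f t) → Matches (take r V) f
  matches-take (suc r) (x ∷ V) f match zero    _        = match zero (s≤s z≤n) (s≤s z≤n)
  matches-take (suc r) (x ∷ V) f match (suc t) (s≤s t<) =
    matches-take r V (λ t → f (suc t)) (λ t t<r t<V → match (suc t) (s≤s t<r) (s≤s t<V)) t t<

  matches-replicate : ∀ c V f → (∀ s → s < c → Matches V (λ t → f (s * length V + t))) →
    Matches (concat (replicate c V)) f
  matches-replicate (suc c) V f blocks = matches-++ V _ f (blocks 0 (s≤s z≤n))
    (matches-replicate c V (λ t → f (length V + t)) λ s s<c →
      matches-cong V (λ t → cong f (ℕP.+-assoc (length V) (s * length V) t)) (blocks (suc s) (s≤s s<c)))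

  length-concat-replicate : ∀ c (V : List C) → length (concat (replicate c V)) ≡ c * length V
  length-concat-replicate zero    V = ≡.refl
  length-concat-replicate (suc c) V = ≡.trans (length-++ V) (cong (length V +_) (length-concat-replicate c V))

  pow-shape : ∀ V k d → length V ≡ suc d →
    pow F V k d ≡ concat (replicate (k / suc d) V) ++ take (k % suc d) V
  pow-shape V k d |V|≡p = cong (λ z → concat (replicate (k / suc d) V) ++ take z V) (begin
    ceilDivSuc F (r * length V) d  ≡⟨ cong (λ z → ceilDivSuc F (r * z) d) |V|≡p ⟩
    (r * suc d + d) / suc d         ≡⟨ +-distrib-/-∣ˡ d (n∣m*n r) ⟩
    r * suc d / suc d + d / suc d   ≡⟨ cong₂ _+_ (m*n/n≡m r (suc d)) (m<n⇒m/n≡0 (ℕP.n<1+n d)) ⟩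
    r + 0                           ≡⟨ ℕP.+-identityʳ r ⟩
    r                               ∎)
    where
    open ≡.≡-Reasoning
    r : ℕ
    r = k % suc d

  length-pow : ∀ V k d → length V ≡ suc d → length (pow F V k d) ≡ k
  length-pow V k d |V|≡p = begin
    length (pow F V k d)                                         ≡⟨ cong length (pow-shape V k d |V|≡p) ⟩
    length (concat (replicate (k / p) V) ++ take (k % p) V)      ≡⟨ length-++ (concat (replicate (k / p) V)) ⟩
    length (concat (replicate (k / p) V)) + length (take (k % p) V)
      ≡⟨ cong₂ _+_ (≡.trans (length-concat-replicate (k / p) V) (cong (k / p *_) |V|≡p))
                   (≡.trans (length-take (k % p) V) (ℕP.m≤n⇒m⊓n≡m k%p≤|V|)) ⟩
    k / p * p + k % p                                            ≡⟨ ℕP.+-comm (k / p * p) (k % p) ⟩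
    k % p + k / p * p                                            ≡⟨ ≡.sym (m≡m%n+[m/n]*n k p) ⟩
    k                                                            ∎
    where
    open ≡.≡-Reasoning
    p : ℕ
    p = suc d
    k%p≤|V| : k % p ℕ.≤ length V
    k%p≤|V| = subst (k % p ℕ.≤_) (≡.sym |V|≡p) (ℕP.<⇒≤ (m%n<n k p))

  period-iterate : ∀ (f : ℕ → C) p k → (∀ t → p + t < k → f t ≈ f (p + t)) →
    ∀ s t → s * p + t < k → f t ≈ f (s * p + t)
  period-iterate f p k period zero    t _  = refl
  period-iterate f p k period (suc s) t lt =
    trans (period-iterate f p k period s t (ℕP.≤-<-trans (ℕP.m≤n+m (s * p + t) p) lt′))
          (subst (λ z → f (s * p + t) ≈ f z) (≡.sym (ℕP.+-assoc p (s * p) t)) (period (s * p + t) lt′))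
    where
    lt′ : p + (s * p + t) < k
    lt′ = subst (_< k) (ℕP.+-assoc p (s * p) t) lt

  pow-matches : ∀ V k d f → length V ≡ suc d → Matches V f →
    (∀ t → suc d + t < k → f t ≈ f (suc d + t)) → Matches (pow F V k d) f
  pow-matches V k d f |V|≡p matchV period rewrite pow-shape V k d |V|≡p =
    matches-++ (concat (replicate (k / p) V)) _ f
      (matches-replicate (k / p) V f full-block)
      (matches-cong (take (k % p) V) (λ t → cong (λ z → f (z + t)) (≡.sym |blocks|))
        (matches-take (k % p) V _ last-block))
    where
    p : ℕ
    p = suc d
    |blocks| : length (concat (replicate (k / p) V)) ≡ k / p * p
    |blocks| = ≡.trans (length-concat-replicate (k / p) V) (cong (k / p *_) |V|≡p)
    k≡ : k ≡ k / p * p + k % p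
    k≡ = ≡.trans (m≡m%n+[m/n]*n k p) (ℕP.+-comm (k % p) (k / p * p))
    full-block : ∀ s → s < k / p → Matches V (λ t → f (s * length V + t))
    full-block s s<k/p t t<|V| = subst (λ z → coeff F V t ≈ f (s * z + t)) (≡.sym |V|≡p)
      (trans (matchV t t<|V|) (period-iterate f p k period s t (subst (s * p + t <_) (≡.sym k≡) in-range)))
      where
      in-range : s * p + t < k / p * p + k % p
      in-range = ℕP.<-≤-trans (ℕP.+-monoʳ-< (s * p) (subst (t <_) |V|≡p t<|V|))
        (ℕP.≤-trans (ℕP.≤-reflexive (ℕP.+-comm (s * p) p))
          (ℕP.≤-trans (ℕP.*-monoˡ-≤ p s<k/p) (ℕP.m≤m+n (k / p * p) (k % p))))
    last-block : ∀ t → t < k % p → t < length V → coeff F V t ≈ f (k / p * p + t)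
    last-block t t<r t<|V| = trans (matchV t t<|V|)
      (period-iterate f p k period (k / p) t (subst (k / p * p + t <_) (≡.sym k≡) (ℕP.+-monoʳ-< (k / p * p) t<r)))

  prefixOf : (ℕ → C) → ℕ → List C
  prefixOf f zero    = []
  prefixOf f (suc n) = f 0 ∷ prefixOf (λ t → f (suc t)) n

  length-prefixOf : ∀ f n → length (prefixOf f n) ≡ n
  length-prefixOf f zero    = ≡.refl
  length-prefixOf f (suc n) = cong suc (length-prefixOf _ n)

  prefixOf-matches : ∀ f n → Matches (prefixOf f n) f
  prefixOf-matches f (suc n) zero    _        = refl
  prefixOf-matches f (suc n) (suc t) (s≤s t<) = prefixOf-matches (λ t → f (suc t)) n t t<

  periodic-prefix : ∀ a i d N → i ℕ.≤ N → (∀ t → i + suc d + t < N → a (i + t) ≈ a (i + suc d + t)) →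
    IsPrefix F (prefixOf a i ++ pow F (prefixOf (λ t → a (i + t)) (suc d)) (N ∸ i) d) a
  periodic-prefix a i d N i≤N period = matches⇒prefix (prefixOf a i ++ pow F V (N ∸ i) d) a
    (matches-++ (prefixOf a i) (pow F V (N ∸ i) d) a (prefixOf-matches a i)
      (matches-cong (pow F V (N ∸ i) d) (λ t → cong (λ z → a (z + t)) (≡.sym (length-prefixOf a i)))
        (pow-matches V (N ∸ i) d f (length-prefixOf f (suc d)) (prefixOf-matches f (suc d)) shifted-period)))
    where
    f : ℕ → C
    f t = a (i + t)
    V : List C
    V = prefixOf f (suc d)
    shifted-period : ∀ t → suc d + t < N ∸ i → f t ≈ f (suc d + t)
    shifted-period t lt = subst (λ z → f t ≈ a z) (ℕP.+-assoc i (suc d) t)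
      (period t (subst (_< N) (≡.sym (ℕP.+-assoc i (suc d) t))
        (subst (i + (suc d + t) <_) (ℕP.m+[n∸m]≡n i≤N) (ℕP.+-monoʳ-< i lt))))

module Complexity {c ℓ : Level} (F : CommutativeRing c ℓ) where
  open CommutativeRing F using (_≈_; sym; trans) renaming (Carrier to C)
  open import Data.Nat as ℕ using (zero; suc; z≤n; s≤s; _<_)
  open import Data.Fin using (Fin; toℕ; fromℕ<)
  import Data.Fin.Properties as FinP
  import Data.Vec as Vec
  open import Data.List as List using (length)
  import Data.List.Relation.Unary.Any as Any
  open import Data.List.Relation.Unary.Any.Properties using (lookup-index)
  open import Data.Product using (∃-syntax; _×_; _,_)
  import Relation.Binary.PropositionalEquality as ≡

  repeated-window : ∀ a m K → ComplexityLe F a m K →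
    ∃[ i ] ∃[ j ] (1 ℕ.≤ i × i < j × j ℕ.≤ suc K × (∀ s → s < m → a (i ℕ.+ s) ≈ a (j ℕ.+ s)))
  repeated-window a m K (L , |L|≤K , covered) with FinP.pigeonhole (s≤s |L|≤K) slot
    where
    slot : Fin (suc K) → Fin (length L)
    slot x = Any.index (covered (suc (toℕ x)))
  ... | x , y , x<y , same-slot = suc (toℕ x) , suc (toℕ y) , s≤s z≤n , s≤s x<y , FinP.toℕ<n y , agree
    where
    letter : Fin (length L) → ∀ s → s < m → C
    letter z s s<m = Vec.lookup (List.lookup L z) (fromℕ< s<m)
    reads : ∀ i s (s<m : s < m) → letter (Any.index (covered i)) s s<m ≈ a (i ℕ.+ s)
    reads i s s<m = ≡.subst (λ z → letter (Any.index (covered i)) s s<m ≈ a (i ℕ.+ z))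
      (FinP.toℕ-fromℕ< s<m) (lookup-index (covered i) (fromℕ< s<m))
    agree : ∀ s → s < m → a (suc (toℕ x) ℕ.+ s) ≈ a (suc (toℕ y) ℕ.+ s)
    agree s s<m = trans (sym (reads (suc (toℕ x)) s s<m))
      (≡.subst (λ z → letter z s s<m ≈ a (suc (toℕ y) ℕ.+ s)) (≡.sym same-slot) (reads (suc (toℕ y)) s s<m))

module Arithmetic where
  open import Data.Nat using (ℕ; suc; _≤_; _<_; _+_; _*_; _∸_)
  open import Data.Nat.Properties
  open import Data.Nat.Tactic.RingSolver using (solve-∀)
  open import Data.Product using (_×_; _,_)
  open import Relation.Binary.PropositionalEquality using (_≡_)

  -- The constant 8(κ+1)²(2κ+1) of Theorem A.2 minus one, written so that it visibly exceeds κ.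
  constA2-pred : ℕ → ℕ
  constA2-pred κ = suc κ + (16 * (κ * κ * κ) + 40 * (κ * κ) + 31 * κ + 6)

  constA2≡suc : ∀ κ → constA2 κ ≡ suc (constA2-pred κ)
  constA2≡suc κ = expand κ
    where
    expand : ∀ κ → 8 * ((κ + 1) * (κ + 1)) * (2 * κ + 1)
                 ≡ suc (suc κ + (16 * (κ * κ * κ) + 40 * (κ * κ) + 31 * κ + 6))
    expand = solve-∀

  κ<constA2-pred : ∀ κ → κ < constA2-pred κ
  κ<constA2-pred κ = m≤m+n (suc κ) _

  -- The choice of the height bound H = P + κn₀ + 1 leaves room for κ(h + n₀) + P + 1 letters below hK.
  budget : ∀ κ K h n₀ P → κ < K → P + κ * n₀ + 1 ≤ h → κ * (h + n₀) + P + 1 ≤ h * K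
  budget κ K h n₀ P κ<K H≤h = begin
    κ * (h + n₀) + P + 1       ≡⟨ regroup κ h n₀ P ⟩
    κ * h + (P + κ * n₀ + 1)   ≤⟨ +-monoʳ-≤ (κ * h) H≤h ⟩
    κ * h + h                  ≡⟨ factor κ h ⟩
    h * suc κ                  ≤⟨ *-monoʳ-≤ h κ<K ⟩
    h * K                      ∎
    where
    open ≤-Reasoning
    regroup : ∀ κ h n₀ P → κ * (h + n₀) + P + 1 ≡ κ * h + (P + κ * n₀ + 1)
    regroup = solve-∀
    factor : ∀ κ h → κ * h + h ≡ h * suc κ
    factor = solve-∀

  room : ∀ {i j B P M n} → i < j → j ≤ suc B → B + P + 1 ≤ M → M < n → j ≤ M × P < n ∸ i
  room {i} {j} {B} {P} {M} {n} i<j j≤1+B B+P+1≤M M<n =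
    ≤-trans j≤1+B (≤-trans (≤-reflexive (+-comm 1 B)) (≤-trans (+-monoˡ-≤ 1 (m≤m+n B P)) B+P+1≤M)) ,
    m+n≤o⇒m≤o∸n (suc P) (≤-trans P+i<B+P+1 (≤-trans B+P+1≤M (<⇒≤ M<n)))
    where
    P+i<B+P+1 : suc (P + i) ≤ B + P + 1
    P+i<B+P+1 = ≤-trans (≤-reflexive (+-comm 1 (P + i)))
      (+-monoˡ-≤ 1 (≤-trans (+-monoʳ-≤ P (<⇒≤pred (<-≤-trans i<j j≤1+B))) (≤-reflexive (+-comm P B))))

module ExponentBound {c ℓ : Level} (F : CommutativeRing c ℓ) (fld : IsField F) {q : ℕ} (card : HasCard F q)
  (a : ℕ → CommutativeRing.Carrier F) (n₀ κ : ℕ)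
  (complexity : ∀ n → n₀ ℕ.≤ n → ComplexityLe F a n (κ ℕ.* n)) (ρ : ℚ) where
  open CommutativeRing F using (_≈_; 0#) renaming (Carrier to C)
  open RationalBounds
  open LinearRecurrence F
  open FiniteRing F card
  open Words F
  open Complexity F
  open Arithmetic
  open import Level using (_⊔_)
  open import Data.Nat as ℕ using (zero; suc; z≤n; s≤s; _<_; _+_; _∸_)
  import Data.Nat.Properties as ℕP
  open import Data.Integer as ℤ using (+_; +<+)
  open import Data.Rational using (_/_; 1ℚ)
  import Data.Rational.Properties as ℚP
  open import Data.List using (List; _++_; length)
  open import Data.List.Properties using (length-++)
  open import Data.List.Relation.Unary.Any using (Any)
  open import Data.Product using (_,_; proj₁; proj₂)
  open import Data.Sum using (inj₁; inj₂)
  open import Data.Empty using (⊥-elim)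
  open import Relation.Nullary using (¬_; yes; no)
  open import Relation.Binary.PropositionalEquality as ≡ using (_≡_; cong; cong₂)

  -- One instance of condition (*)_ρ: a prefix U V^w of a with |U V^w| ≥ ρ|UV| and |V^w| > P.
  record Witness (P : ℕ) : Set (c ⊔ ℓ) where
    field
      U V    : List C
      k d    : ℕ
      prefix : IsPrefix F (U ++ pow F V k d) a
      ratio  : ρ ℚ.* (+ length (U ++ V) / 1) ℚ.≤ (+ length (U ++ pow F V k d) / 1)
      long   : P < length (pow F V k d)
  open Witness

  -- (*)_ρ holds as soon as there are witnesses with arbitrarily long repetitions:
  -- choose each witness with repetition longer than the previous one.
  star-from-witnesses : (∀ P → Witness P) → Star F a ρ
  star-from-witnesses witness =
    (λ n → U (chain n)) , (λ n → V (chain n)) , (λ n → k (chain n)) , (λ n → d (chain n)) ,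
    (λ n → prefix (chain n)) , (λ n → ratio (chain n)) , (λ n → long (chain (suc n)))
    where
    bound : ℕ → ℕ
    chain : ∀ n → Witness (bound n)
    bound zero    = 0
    bound (suc n) = length (pow F (V (chain n)) (k (chain n)) (d (chain n)))
    chain n = witness (bound n)

  length/1 : ∀ {W : List C} {n} → length W ≡ n → + length W / 1 ≡ fromℕ n
  length/1 {n = n} |W|≡n = ≡.trans (cong (λ m → + m / 1) |W|≡n) (/1≡fromℤ (+ n))

  periodic-witness : ∀ P i j N → i < j → j ℕ.≤ N → ρ ℚ.* fromℕ j ℚ.≤ fromℕ N → P < N ∸ i →
    (∀ t → j + t < N → a (i + t) ≈ a (j + t)) → Witness P
  periodic-witness P i j N i<j j≤N ρj≤N P<N-i period = record
    { U = Uᵢ ; V = Vᵢ ; k = N ∸ i ; d = p-1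
    ; prefix = periodic-prefix a i p-1 N i≤N period′
    ; ratio  = ≡.subst₂ ℚ._≤_ (cong (ρ ℚ.*_) (≡.sym (length/1 {Uᵢ ++ Vᵢ} |UV|≡j)))
                 (≡.sym (length/1 {Uᵢ ++ pow F Vᵢ (N ∸ i) p-1} |UVʷ|≡N)) ρj≤N
    ; long   = ≡.subst (P <_) (≡.sym |Vʷ|≡N-i) P<N-i
    }
    where
    p-1 : ℕ
    p-1 = j ∸ suc i
    i+p≡j : i + suc p-1 ≡ j
    i+p≡j = ≡.trans (ℕP.+-suc i p-1) (ℕP.m+[n∸m]≡n i<j)
    i≤N : i ℕ.≤ N
    i≤N = ℕP.<⇒≤ (ℕP.<-≤-trans i<j j≤N)
    Uᵢ : List C
    Uᵢ = prefixOf a i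
    f : ℕ → C
    f t = a (i + t)
    Vᵢ : List C
    Vᵢ = prefixOf f (suc p-1)
    period′ : ∀ t → i + suc p-1 + t < N → a (i + t) ≈ a (i + suc p-1 + t)
    period′ t = ≡.subst (λ z → z + t < N → a (i + t) ≈ a (z + t)) (≡.sym i+p≡j) (period t)
    |Vʷ|≡N-i : length (pow F Vᵢ (N ∸ i) p-1) ≡ N ∸ i
    |Vʷ|≡N-i = length-pow Vᵢ (N ∸ i) p-1 (length-prefixOf f (suc p-1))
    |UV|≡j : length (Uᵢ ++ Vᵢ) ≡ j
    |UV|≡j = ≡.trans (length-++ Uᵢ) (≡.trans (cong₂ _+_ (length-prefixOf a i) (length-prefixOf f (suc p-1))) i+p≡j)
    |UVʷ|≡N : length (Uᵢ ++ pow F Vᵢ (N ∸ i) p-1) ≡ N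
    |UVʷ|≡N = ≡.trans (length-++ Uᵢ) (≡.trans (cong₂ _+_ (length-prefixOf a i) |Vʷ|≡N-i) (ℕP.m+[n∸m]≡n i≤N))

  -- For ρ ≤ 1 every sequence satisfies (*)_ρ: take U empty and V = a_0 … a_P.
  short-witness : ρ ℚ.≤ 1ℚ → ∀ P → Witness P
  short-witness ρ≤1 P = periodic-witness P 0 (suc P) (suc P) (s≤s z≤n) ℕP.≤-refl (scale-≤ ρ (suc P) ρ≤1)
    ℕP.≤-refl (λ t 1+P+t<1+P → ⊥-elim (ℕP.m+n≮m (suc P) t 1+P+t<1+P))

  height-exceeds : ∀ H A B h → HeightExp F A B h → ¬ Any (PEq F (A , B)) (boundedPolys H) → H ℕ.≤ h
  height-exceeds H A B h (_ , high) new with H ℕ.≤? h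
  ... | yes H≤h = H≤h
  ... | no  H≰h = ⊥-elim (new (boundedPolys-complete H A B (λ i H≤i → proj₁ (high i (h<i H≤i)))
                                                           (λ i H≤i → proj₂ (high i (h<i H≤i)))))
    where
    h<i : ∀ {i} → H ℕ.≤ i → h < i
    h<i = ℕP.<-≤-trans (ℕP.≰⇒> H≰h)

  -- The pigeonhole principle gives two
  -- equal windows of length h + n₀ ≥ deg A at positions i < j ≤ κ(h + n₀) + 1; the recurrence makes
  -- a_0 … a_{n-1} periodic from i on, so it is a word U V^w with |UV| = j ≤ hK and |V^w| = n - i > P.
  witness-from-recurrence : ∀ K P A h n → κ < K → P + κ ℕ.* n₀ + 1 ℕ.≤ h →
    (∀ i → h < i → coeff F A i ≈ 0#) → ¬ (mulAt F A (λ t → a (t + n)) ≈ 0#) →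
    (∀ x → 1 ℕ.≤ x → x < n → mulAt F A (λ t → a (t + x)) ≈ 0#) →
    h ℕ.* K < n → (∀ x → x ℕ.≤ h ℕ.* K → ρ ℚ.* fromℕ x ℚ.≤ fromℕ n) → Witness P
  witness-from-recurrence K P A h n κ<K H≤h high last recurrence hK<n scaled
    with degree-or-zero A h high
  ... | inj₂ A≈0 = ⊥-elim (last (mulAt-zero A _ A≈0))
  ... | inj₁ (d , d≤h , deg)
    with repeated-window a (h + n₀) (κ ℕ.* (h + n₀)) (complexity (h + n₀) (ℕP.m≤n+m n₀ h))
  ... | i , j , 1≤i , i<j , j≤ , window
    with room i<j j≤ (budget κ K h n₀ P κ<K H≤h) hK<n
  ... | j≤hK , P<n-i = periodic-witness P i j n i<j (ℕP.<⇒≤ (ℕP.≤-<-trans j≤hK hK<n)) (scaled j j≤hK) P<n-i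
    (window-propagates fld a {A} n i j deg recurrence 1≤i i<j
      (λ s s<d → window s (ℕP.<-≤-trans s<d (ℕP.≤-trans d≤h (ℕP.m≤m+n h n₀)))))

  -- If (K + 1)ρ - 1 < w with ρ > 1, infinitely many good approximations give witnesses of every length:
  -- an approximation A X + B of large height h has |Aξ + B| = q^{-N} with hw ≤ N, hence N > hK, and the
  -- vanishing coefficients of T^{-1}, …, T^{1-N} in Aξ + B form the recurrence of the core step.
  long-witness : ∀ w K → κ < K → fromℕ (suc K) ℚ.* ρ ℚ.- 1ℚ ℚ.< w → 1ℚ ℚ.< ρ →
    InfinitelyMany F a w → ∀ P → Witness P
  long-witness w K κ<K gap 1<ρ approximations P
    with approximations (boundedPolys (P + κ ℕ.* n₀ + 1))
  ... | (A , B) , (h , N , height , (last , earlier) , hw≤N) , new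
    with height-exceeds (P + κ ℕ.* n₀ + 1) A B h height new
  ... | H≤h
    with scaled-height-bound ρ w K h N gap 1<ρ (ℕP.≤-trans (ℕP.m≤n+m 1 (P + κ ℕ.* n₀)) H≤h)
           (≡.subst₂ (λ x y → x ℚ.* w ℚ.≤ y) (/1≡fromℤ (+ h)) (/1≡fromℤ N) hw≤N)
  ... | zero  , _     , ()   , _
  ... | suc n , ≡.refl , hK<n , scaled = witness-from-recurrence K P A h (suc n) κ<K H≤h
    (λ i h<i → proj₁ (proj₂ height i h<i)) last
    (λ { zero () _ ; (suc x) _ x<n → earlier (+ suc x) (+<+ x<n) }) hK<n scaled

  exponent-bound : ∀ w K → κ < K → ¬ Star F a ρ → fromℕ (suc K) ℚ.* ρ ℚ.- 1ℚ ℚ.< w → ¬ InfinitelyMany F a w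
  exponent-bound w K κ<K no-star gap approximations with ρ ℚP.≤? 1ℚ
  ... | yes ρ≤1 = no-star (star-from-witnesses (short-witness ρ≤1))
  ... | no  ρ≰1 = no-star (star-from-witnesses (long-witness w K κ<K gap (ℚP.≰⇒> ρ≰1) approximations))

open import Data.Nat using (ℕ; _≤_; _^_)
open import Data.Nat.Primality using (Prime)
open import Data.Integer using (+_)
open import Data.Rational using (ℚ; _/_; _*_; _-_; _<_; 1ℚ)
open import Relation.Nullary using (¬_)
open import Relation.Binary.PropositionalEquality using (_≡_; subst; trans; cong)
open RationalBounds using (fromℕ; /1≡fromℤ)
open Arithmetic using (constA2-pred; constA2≡suc; κ<constA2-pred)

-- Theorem A.2.
theoremA2 : ∀ {c ℓ} (F : CommutativeRing c ℓ) → IsField F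
    → (p k q : ℕ) → Prime p → 1 ≤ k → q ≡ p ^ k → HasCard F q
    → (a : ℕ → CommutativeRing.Carrier F) → ¬ UltPeriodic F a
    → (n₀ κ : ℕ) → 1 ≤ n₀ → 2 ≤ κ
    → (∀ n → n₀ ≤ n → ComplexityLe F a n (κ Data.Nat.* n))
    → (ρ w : ℚ) → ¬ Star F a ρ
    → (+ constA2 κ / 1) * ρ - 1ℚ < w
    → ¬ InfinitelyMany F a w
theoremA2 F fld p k q _ _ _ card a _ n₀ κ _ _ complexity ρ w no-star gap =
  ExponentBound.exponent-bound F fld card a n₀ κ complexity ρ w K (κ<constA2-pred κ) no-star gap′
  where
  K : ℕ
  K = constA2-pred κ
  gap′ : fromℕ (ℕ.suc K) * ρ - 1ℚ < w
  gap′ = subst (λ r → r * ρ - 1ℚ < w) (trans (/1≡fromℤ (+ constA2 κ)) (cong fromℕ (constA2≡suc κ))) gap
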